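{- Let $A,B,C$ be sets and let $\theta_{XY}\colon I_{XY}\to T_X(Y\times I_{XY})$ denote a final coalgebra for the functor $T_X(Y\times -)$ on $\mathbf{Set}$, for $(X,Y)\in\{(A,B),(B,C),(A,C)\}$. Let $\mathsf{comp}\colon I_{BC}\times I_{AB}\to I_{AC}$ be the unique coalgebra map from the tensor product $I_{BC}\cdot I_{AB}$ (a $T_A(C\times-)$-coalgebra) to $(I_{AC},\theta_{AC})$. Let $S=T_B(C\times I_{BC})\times T_A(B\times I_{AB})$, let $\chi\colon S\to T_A(C\times S)$ be defined by the clauses $\chi((c,\tau),u)=(c,\theta_{BC}(\tau),u)$ for $(c,\tau)\in C\times I_{BC}$; $\chi(\mathsf{read}(t),(b,\sigma))=\chi(t_b,\theta_{AB}(\sigma))$ for $t\in T_B(C\times I_{BC})^B$, $(b,\sigma)\in B\times I_{AB}$; $\chi(\mathsf{read}(t),\mathsf{read}(u))=\mathsf{read}(\lambda a.\,\chi(\mathsf{read}(t),u_a))$ for $t\in T_B(C\times I_{BC})^B$, $u\in T_A(B\times I_{AB})^A$; and let $u\colon S\to I_{AC}$ be the unique coalgebra map from $(S,\chi)$ to $(I_{AC},\theta_{AC})$. Then $\mathsf{comp}=u\circ(\theta_{BC}\times\theta_{AB})$.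
   Context: For a set $X$, $T_X(V)$ is the set of well-founded $X$-ary branching trees with leaves labelled in $V$: a leaf $v\in V$, or $\mathsf{read}(\lambda x.\,t_x)$ with $t\in T_X(V)^X$; $T_X$ is a functor acting on leaf labels. For $t\in T_X(V)$ and $w\colon V\to T_X(W)$, $t(w)\in T_X(W)$ is the tree obtained by replacing each leaf $v$ by $w(v)$. The tensor product $I_{BC}\cdot I_{AB}$ is the $T_A(C\times -)$-coalgebra with carrier $I_{BC}\times I_{AB}$ and structure map $(\tau,\sigma)\mapsto [\![\theta_{BC}(\tau)]\!](\sigma)$, where for $t\in T_B(V)$ the map $[\![t]\!]\colon I_{AB}\to T_A(V\times I_{AB})$ is defined recursively by $[\![v]\!](\sigma)=(v,\sigma)$ (a leaf) and $[\![\mathsf{read}(\lambda b.\,t_b)]\!](\sigma)=\theta_{AB}(\sigma)\bigl(\lambda(b,\sigma').\,[\![t_b]\!](\sigma')\bigr)$. A coalgebra map $f\colon(X,\alpha)\to(Y,\beta)$ for $T_A(C\times-)$ is a function with $\beta\circ f=T_A(C\times f)\circ\alpha$. -}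

module Defs where

open import Data.Product using (_×_; _,_; proj₁; proj₂)
open import Relation.Binary.PropositionalEquality using (_≡_)

data T (X : Set) (V : Set) : Set where
  leaf : V → T X V
  read : (X → T X V) → T X V

mapT : {X V W : Set} → (V → W) → T X V → T X W
mapT f (leaf v) = leaf (f v)
mapT f (read t) = read (λ x → mapT f (t x))

substT : {X V W : Set} → T X V → (V → T X W) → T X W
substT (leaf v) w = w v
substT (read t) w = read (λ x → substT (t x) w)

-- Equality of trees (extensional in the branching functions, as in Set).
data _≈T_ {X V : Set} : T X V → T X V → Set where
  leaf≈ : {v w : V} → v ≡ w → leaf v ≈T leaf w
  read≈ : {t u : X → T X V} → (∀ x → t x ≈T u x) → read t ≈T read u

FT : {A C Z W : Set} → (Z → W) → T A (C × Z) → T A (C × W)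
FT f = mapT (λ p → (proj₁ p , f (proj₂ p)))

IsCoalgMap : (A C : Set) {Z W : Set} → (Z → T A (C × Z)) → (W → T A (C × W)) → (Z → W) → Set
IsCoalgMap A C α β f = ∀ z → β (f z) ≈T FT f (α z)

record IsFinal (A C I : Set) (θ : I → T A (C × I)) : Set₁ where
  field
    unfold     : {Z : Set} → (Z → T A (C × Z)) → Z → I
    unfold-map : {Z : Set} (α : Z → T A (C × Z)) → IsCoalgMap A C α θ (unfold α)
    unique     : {Z : Set} (α : Z → T A (C × Z)) (f g : Z → I) →
                 IsCoalgMap A C α θ f → IsCoalgMap A C α θ g → ∀ z → f z ≡ g z

module _ {A B C IAB IBC : Set}
         (θAB : IAB → T A (B × IAB)) (θBC : IBC → T B (C × IBC)) where

  ⟦_⟧ : {V : Set} → T B V → IAB → T A (V × IAB)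
  ⟦ leaf v ⟧ σ = leaf (v , σ)
  ⟦ read t ⟧ σ = substT (θAB σ) (λ p → ⟦ t (proj₁ p) ⟧ (proj₂ p))

  tensor : IBC × IAB → T A (C × (IBC × IAB))
  tensor (τ , σ) = mapT (λ p → (proj₁ (proj₁ p) , (proj₂ (proj₁ p) , proj₂ p))) (⟦ θBC τ ⟧ σ)

  S : Set
  S = T B (C × IBC) × T A (B × IAB)

  mutual
    χc : T B (C × IBC) → T A (B × IAB) → T A (C × S)
    χc (leaf (c , τ)) u = leaf (c , (θBC τ , u))
    χc (read t) u = χr t u

    χr : (B → T B (C × IBC)) → T A (B × IAB) → T A (C × S)
    χr t (leaf (b , σ)) = χc (t b) (θAB σ)
    χr t (read u) = read (λ a → χr t (u a))

  χ : S → T A (C × S)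
  χ (s , u) = χc s u

{-# OPTIONS --safe #-}
-- The pair of structure maps θBC × θAB is itself a coalgebra morphism from the
-- tensor product I_BC · I_AB to (S, χ): unfolding χ on θBC τ and θAB σ replays
-- the interpretation ⟦ θBC τ ⟧ σ step by step. Hence u ∘ (θBC × θAB) is a
-- coalgebra map into the final coalgebra I_AC, and finality identifies it with comp.
module Submission where

open import Defs
open import Data.Product using (_×_; _,_; proj₁; proj₂)
open import Relation.Binary.PropositionalEquality using (_≡_; refl; sym; trans; cong)

≈T-sym : {X V : Set} {t u : T X V} → t ≈T u → u ≈T t
≈T-sym (leaf≈ e) = leaf≈ (sym e)
≈T-sym (read≈ f) = read≈ (λ x → ≈T-sym (f x))

≈T-trans : {X V : Set} {t u w : T X V} → t ≈T u → u ≈T w → t ≈T w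
≈T-trans (leaf≈ e) (leaf≈ e′) = leaf≈ (trans e e′)
≈T-trans (read≈ f) (read≈ g) = read≈ (λ x → ≈T-trans (f x) (g x))

mapT-cong : {X V W : Set} (f : V → W) {t u : T X V} → t ≈T u → mapT f t ≈T mapT f u
mapT-cong f (leaf≈ e) = leaf≈ (cong f e)
mapT-cong f (read≈ g) = read≈ (λ x → mapT-cong f (g x))

mapT-∘ : {X U V W : Set} (f : V → W) (g : U → V) (t : T X U) →
         mapT f (mapT g t) ≈T mapT (λ x → f (g x)) t
mapT-∘ f g (leaf v) = leaf≈ refl
mapT-∘ f g (read t) = read≈ (λ x → mapT-∘ f g (t x))

IsCoalgMap-∘ : {A C X Y Z : Set}
               (α : X → T A (C × X)) (β : Y → T A (C × Y)) (γ : Z → T A (C × Z))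
               {g : Y → Z} {f : X → Y} →
               IsCoalgMap A C β γ g → IsCoalgMap A C α β f →
               IsCoalgMap A C α γ (λ x → g (f x))
IsCoalgMap-∘ α _ _ {f = f} g-map f-map x =
  ≈T-trans (g-map (f x))
  (≈T-trans (mapT-cong _ (f-map x))
            (mapT-∘ _ _ (α x)))

module _ {A B C IAB IBC : Set}
         (θAB : IAB → T A (B × IAB)) (θBC : IBC → T B (C × IBC)) where

  θBC×θAB : IBC × IAB → S θAB θBC
  θBC×θAB (τ , σ) = (θBC τ , θAB σ)

  unfoldLeaf : (C × IBC) × IAB → C × S θAB θBC
  unfoldLeaf ((c , τ) , σ) = (c , θBC×θAB (τ , σ))

  mutual
    χc-θAB≈⟦⟧ : (s : T B (C × IBC)) (σ : IAB) →
                χc θAB θBC s (θAB σ) ≈T mapT unfoldLeaf (⟦ θAB ⟧ θBC s σ)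
    χc-θAB≈⟦⟧ (leaf (c , τ)) σ = leaf≈ refl
    χc-θAB≈⟦⟧ (read t)       σ = χr≈substT t (θAB σ)

    χr≈substT : (t : B → T B (C × IBC)) (w : T A (B × IAB)) →
                χr θAB θBC t w ≈T
                mapT unfoldLeaf (substT w (λ p → ⟦ θAB ⟧ θBC (t (proj₁ p)) (proj₂ p)))
    χr≈substT t (leaf (b , σ)) = χc-θAB≈⟦⟧ (t b) σ
    χr≈substT t (read w)       = read≈ (λ a → χr≈substT t (w a))

  θBC×θAB-isCoalgMap : IsCoalgMap A C (tensor θAB θBC) (χ θAB θBC) θBC×θAB
  θBC×θAB-isCoalgMap (τ , σ) =
    ≈T-trans (χc-θAB≈⟦⟧ (θBC τ) σ)
             (≈T-sym (mapT-∘ _ _ (⟦ θAB ⟧ θBC (θBC τ) σ)))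

proposition4p6 : (A B C IAB IBC IAC : Set)
    (θAB : IAB → T A (B × IAB)) (θBC : IBC → T B (C × IBC)) (θAC : IAC → T A (C × IAC))
    → IsFinal A B IAB θAB → IsFinal B C IBC θBC → IsFinal A C IAC θAC
    → (comp : IBC × IAB → IAC) → IsCoalgMap A C (tensor θAB θBC) θAC comp
    → (u : S θAB θBC → IAC) → IsCoalgMap A C (χ θAB θBC) θAC u
    → ∀ τ σ → comp (τ , σ) ≡ u (θBC τ , θAB σ)
proposition4p6 A B C IAB IBC IAC θAB θBC θAC _ _ finalAC comp comp-map u u-map τ σ =
  IsFinal.unique finalAC (tensor θAB θBC) comp (λ z → u (θBC×θAB θAB θBC z))
    comp-map
    (IsCoalgMap-∘ (tensor θAB θBC) (χ θAB θBC) θAC u-map (θBC×θAB-isCoalgMap θAB θBC))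
    (τ , σ)
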